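{- Let $X$ be a finite totally ordered alphabet and $U\subseteq X\times X$. Suppose $\mathrm{inv}'_U$ and $\mathrm{maj}'_U$ are equidistributed on every rearrangement class of words over $X$. Let $x,y$ be two distinct elements of the same block of $X_U$ and let $z\in X$. Then $(z,x)\in U\iff(z,y)\in U$, and $(x,z)\in U\iff(y,z)\in U$.
   Context: $S(U)=\{(x,y):(x,y)\in U\text{ and }(y,x)\in U\}$; $X_U$ is the set of $x\in X$ with $(x,y)\in S(U)$ for some $y$. Under the equidistribution hypothesis $S(U)$ is an equivalence relation on $X_U$, and the blocks of $X_U$ are its equivalence classes (so distinct $x,y$ lie in the same block iff $(x,y)\in S(U)$). Words over $X$: finite sequences $w=x_1\cdots x_m$; a rearrangement class is the set of all words with prescribed numbers of occurrences of each letter. $\mathrm{maj}'_U w=\sum_{i=1}^{m-1}i\,\chi((x_i,x_{i+1})\in U)$, $\mathrm{inv}'_U w=\sum_{1\le i<j\le m}\chi((x_i,x_j)\in U)$. Equidistributed on a class: for each $k$ the numbers of words with statistic value $k$ coincide. -}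

module Defs where

open import Data.Nat using (ℕ; zero; suc; _+_; _*_; _≡ᵇ_)
open import Data.Bool using (Bool; true; false; if_then_else_; _∧_)
open import Data.Fin using (Fin)
open import Data.Fin.Properties using (_≟_)
open import Data.List using (List; []; _∷_; length; concatMap; map; allFin)
open import Data.Vec.Functional using (foldr)
open import Relation.Nullary.Decidable using (⌊_⌋)
open import Relation.Binary.PropositionalEquality using (_≡_)
open import Data.Product using (_×_)

-- Alphabet X = Fin n (totally ordered by the usual order on Fin n).
-- A relation U ⊆ X × X is given by its (decidable) characteristic function;
-- (x , y) ∈ U  means  U x y ≡ true.
Rel : ℕ → Set
Rel n = Fin n → Fin n → Bool

χ : Bool → ℕ
χ true  = 1
χ false = 0

Word : ℕ → Set
Word n = List (Fin n)

-- maj'_U w = Σ_{i=1}^{m-1} i · χ((x_i , x_{i+1}) ∈ U)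
-- helper: position i of the current first letter
majFrom : ∀ {n} → Rel n → ℕ → Word n → ℕ
majFrom U i []            = 0
majFrom U i (a ∷ [])      = 0
majFrom U i (a ∷ b ∷ w)   = i * χ (U a b) + majFrom U (suc i) (b ∷ w)

maj′ : ∀ {n} → Rel n → Word n → ℕ
maj′ U w = majFrom U 1 w

countRel : ∀ {n} → Rel n → Fin n → Word n → ℕ
countRel U a []      = 0
countRel U a (b ∷ w) = χ (U a b) + countRel U a w

inv′ : ∀ {n} → Rel n → Word n → ℕ
inv′ U []      = 0
inv′ U (a ∷ w) = countRel U a w + inv′ U w

occ : ∀ {n} → Fin n → Word n → ℕ
occ a []      = 0
occ a (b ∷ w) = (if ⌊ a ≟ b ⌋ then 1 else 0) + occ a w

wordsOfLength : (n m : ℕ) → List (Word n)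
wordsOfLength n zero    = [] ∷ []
wordsOfLength n (suc m) = concatMap (λ a → map (a ∷_) (wordsOfLength n m)) (allFin n)

-- total length of a content vector c (prescribed numbers of occurrences)
total : ∀ {n} → (Fin n → ℕ) → ℕ
total {n} c = foldr _+_ 0 c

inClassᵇ : ∀ {n} → (Fin n → ℕ) → Word n → Bool
inClassᵇ {n} c w = Data.List.foldr _∧_ true (map (λ a → occ a w ≡ᵇ c a) (allFin n))

countStat : ∀ {n} → (Word n → ℕ) → (Fin n → ℕ) → ℕ → ℕ
countStat {n} stat c k =
  length (Data.List.filterᵇ (λ w → inClassᵇ c w ∧ (stat w ≡ᵇ k)) (wordsOfLength n (total c)))

EquidistributedOnAllClasses : ∀ {n} → Rel n → Set
EquidistributedOnAllClasses {n} U =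
  (c : Fin n → ℕ) (k : ℕ) → countStat (inv′ U) c k ≡ countStat (maj′ U) c k

S : ∀ {n} → Rel n → Fin n → Fin n → Set
S U x y = (U x y ≡ true) × (U y x ≡ true)

-- Under the equidistribution hypothesis the blocks of X_U are the classes of S(U):
-- distinct x, y lie in the same block iff (x , y) ∈ S(U).
DistinctSameBlock : ∀ {n} → Rel n → Fin n → Fin n → Set
DistinctSameBlock U x y = (x Relation.Binary.PropositionalEquality.≢ y) × S U x y

{-# OPTIONS --safe #-}

-- The hypothesis passes to every subalphabet: an injection f : Fin m → Fin n identifies the
-- words over Fin m with the words over Fin n whose letters all lie in the image of f, preserving
-- rearrangement classes and both statistics, so the restriction of U along f is again
-- equidistributed.  Two small alphabets then suffice, each looked at only at the value 2.
-- On {x, y}, with (x,y), (y,x) ∈ U, the three words of the class of xxy all have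
-- inv′ = 2 + [(x,x) ∈ U], while their maj′ values are 2 + [(x,x) ∈ U], 3 and 1 + 2[(x,x) ∈ U];
-- hence (x,x) ∈ U, and likewise (y,y) ∈ U, which settles z ∈ {x, y}.  For z ∉ {x, y}, counting
-- the permutations of xyz with statistic value 2 rules out every choice of the four entries
-- (x,z), (y,z), (z,x), (z,y) that separates x from y.
module Submission where

open import Defs
import Algebra.Properties.CommutativeMonoid.Sum as Sum
open import Data.Bool using (Bool; true; false; if_then_else_; _∧_; T; T?)
open import Data.Bool.Properties using (T-∧)
open import Data.Empty using (⊥-elim)
open import Data.Fin using (Fin; zero; suc)
open import Data.Fin.Patterns using (0F; 1F; 2F)
open import Data.Fin.Properties using (_≟_; any?; suc-injective)
open import Data.List using (List; []; _∷_; _++_; length; map; concatMap; allFin; tabulate; filterᵇ)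
open import Data.List.Properties using (length-++; filter-++; filter-≐)
open import Data.List.Relation.Unary.All as All using (All; []; _∷_)
open import Data.List.Relation.Unary.All.Properties using (all⁺; all⁻; tabulate⁺; tabulate⁻)
open import Data.Nat using (ℕ; zero; suc; _+_; _*_; _≡ᵇ_)
open import Data.Nat.Properties using (+-0-commutativeMonoid; +-identityʳ; 1+n≢0; m+n≡0⇒n≡0; ≡ᵇ⇒≡; ≡⇒≡ᵇ)
open import Data.Product as Product using (_×_; _,_; ∃; proj₁; swap)
open import Data.Product.Function.NonDependent.Propositional using (_×-⇔_)
open import Data.Vec as Vec using (Vec; []; _∷_; lookup)
open import Data.Vec.Properties using (lookup∘tabulate)
open import Data.Vec.Relation.Unary.All using ([]; _∷_)
open import Data.Vec.Relation.Unary.AllPairs using ([]; _∷_)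
open import Data.Vec.Relation.Unary.Unique.Propositional using (Unique)
open import Data.Vec.Relation.Unary.Unique.Propositional.Properties using (lookup-injective)
open import Function using (id; _∘_; _⇔_; mk⇔; Equivalence)
open import Function.Definitions using (Injective)
open import Function.Properties.Equivalence using () renaming (refl to ⇔-refl; sym to ⇔-sym; trans to ⇔-trans)
open import Relation.Binary.PropositionalEquality
open import Relation.Nullary using (¬_; yes; no)
open import Relation.Nullary.Decidable using (⌊_⌋; Dec)

open Sum +-0-commutativeMonoid using (sum; sum-syntax; ∑-comm; sum-cong-≗; sum-replicate-zero)

δ : ∀ {n} → Fin n → Fin n → ℕ
δ a b = if ⌊ a ≟ b ⌋ then 1 else 0

δ-refl : ∀ {n} (a : Fin n) → δ a a ≡ 1
δ-refl a with a ≟ a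
... | yes _  = refl
... | no a≢a = ⊥-elim (a≢a refl)

δ-≢ : ∀ {n} {a b : Fin n} → a ≢ b → δ a b ≡ 0
δ-≢ {a = a} {b} a≢b with a ≟ b
... | yes a≡b = ⊥-elim (a≢b a≡b)
... | no _    = refl

δ-sym : ∀ {n} (a b : Fin n) → δ a b ≡ δ b a
δ-sym a b with a ≟ b | b ≟ a
... | yes _   | yes _   = refl
... | no  _   | no  _   = refl
... | yes a≡b | no  b≢a = ⊥-elim (b≢a (sym a≡b))
... | no  a≢b | yes b≡a = ⊥-elim (a≢b (sym b≡a))

δ-injective : ∀ {m n} (f : Fin m → Fin n) → Injective _≡_ _≡_ f → ∀ a b → δ (f a) (f b) ≡ δ a b
δ-injective f f-injective a b with a ≟ b
... | yes refl = δ-refl (f a)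
... | no a≢b = δ-≢ (a≢b ∘ f-injective)

∑-zero : ∀ {n} {F : Fin n → ℕ} → (∀ a → F a ≡ 0) → sum F ≡ 0
∑-zero {n} F≗0 = trans (sum-cong-≗ F≗0) (sum-replicate-zero n)

∑-δ : ∀ {n} (b : Fin n) (G : Fin n → ℕ) → ∑[ a < n ] (δ a b * G a) ≡ G b
∑-δ {suc n} zero G = begin
  G zero + 0 + ∑[ a < n ] 0  ≡⟨ cong (G zero + 0 +_) (sum-replicate-zero n) ⟩
  G zero + 0 + 0             ≡⟨ +-identityʳ _ ⟩
  G zero + 0                 ≡⟨ +-identityʳ _ ⟩
  G zero                     ∎
  where open ≡-Reasoning
∑-δ {suc n} (suc b) G = begin
  ∑[ a < n ] (δ (suc a) (suc b) * G (suc a))  ≡⟨ sum-cong-≗ (λ a → cong (_* G (suc a)) (δ-injective suc suc-injective a b)) ⟩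
  ∑[ a < n ] (δ a b * G (suc a))              ≡⟨ ∑-δ b (G ∘ suc) ⟩
  G (suc b)                                   ∎
  where open ≡-Reasoning

private variable A B : Set

count : (A → Bool) → List A → ℕ
count P xs = length (filterᵇ P xs)

count-++ : ∀ (P : A → Bool) xs ys → count P (xs ++ ys) ≡ count P xs + count P ys
count-++ P xs ys = trans (cong length (filter-++ (T? ∘ P) xs ys)) (length-++ (filterᵇ P xs))

count-cong : ∀ {P Q : A → Bool} → (∀ x → T (P x) ⇔ T (Q x)) → ∀ xs → count P xs ≡ count Q xs
count-cong {P = P} {Q} P⇔Q =
  cong length ∘ filter-≐ (T? ∘ P) (T? ∘ Q) (Equivalence.to (P⇔Q _) , Equivalence.from (P⇔Q _))

count-none : ∀ {P : A → Bool} → (∀ x → ¬ T (P x)) → ∀ xs → count P xs ≡ 0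
count-none ¬P [] = refl
count-none {P = P} ¬P (x ∷ xs) with P x in Px
... | true  = ⊥-elim (¬P x (subst T (sym Px) _))
... | false = count-none ¬P xs

count-map : ∀ (P : B → Bool) (g : A → B) xs → count P (map g xs) ≡ count (P ∘ g) xs
count-map P g [] = refl
count-map P g (x ∷ xs) with P (g x)
... | true  = cong suc (count-map P g xs)
... | false = count-map P g xs

count-concatMap-tabulate : ∀ {k} (P : B → Bool) (g : A → List B) (h : Fin k → A) →
  count P (concatMap g (tabulate h)) ≡ ∑[ a < k ] count P (g (h a))
count-concatMap-tabulate {k = zero}  P g h = refl
count-concatMap-tabulate {k = suc k} P g h =
  trans (count-++ P (g (h zero)) _) (cong (count P (g (h zero)) +_) (count-concatMap-tabulate P g (h ∘ suc)))

count-words-suc : ∀ {n} (P : Word n → Bool) len →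
  count P (wordsOfLength n (suc len)) ≡ ∑[ a < n ] count (P ∘ (a ∷_)) (wordsOfLength n len)
count-words-suc {n} P len =
  trans (count-concatMap-tabulate P (λ a → map (a ∷_) (wordsOfLength n len)) id)
        (sum-cong-≗ (λ a → count-map P (a ∷_) (wordsOfLength n len)))

InClass : ∀ {n} → (Fin n → ℕ) → Word n → Set
InClass c w = ∀ a → occ a w ≡ c a

inClassᵇ⇔ : ∀ {n} (c : Fin n → ℕ) w → T (inClassᵇ c w) ⇔ InClass c w
inClassᵇ⇔ {n} c w = mk⇔
  (λ t a → ≡ᵇ⇒≡ _ _ (tabulate⁻ (all⁺ (λ b → occ b w ≡ᵇ c b) (allFin n) t) a))
  (λ h → all⁻ (λ b → occ b w ≡ᵇ c b) (tabulate⁺ (λ a → ≡⇒≡ᵇ _ _ (h a))))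

module _ {m n} {U : Rel n} {V : Rel m} {f : Fin m → Fin n} (V-restricts : ∀ i j → V i j ≡ U (f i) (f j)) where

  inv′-map : ∀ w → inv′ U (map f w) ≡ inv′ V w
  inv′-map []      = refl
  inv′-map (a ∷ w) = cong₂ _+_ (countRel-map w) (inv′-map w)
    where
    countRel-map : ∀ w → countRel U (f a) (map f w) ≡ countRel V a w
    countRel-map []      = refl
    countRel-map (b ∷ w) = cong₂ _+_ (cong χ (sym (V-restricts a b))) (countRel-map w)

  majFrom-map : ∀ i w → majFrom U i (map f w) ≡ majFrom V i w
  majFrom-map i []          = refl
  majFrom-map i (a ∷ [])    = refl
  majFrom-map i (a ∷ b ∷ w) =
    cong₂ _+_ (cong (λ u → i * χ u) (sym (V-restricts a b))) (majFrom-map (suc i) (b ∷ w))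

module SubAlphabet {m n} (f : Fin m → Fin n) (f-injective : Injective _≡_ _≡_ f) where

  Image : Fin n → Set
  Image a = ∃ λ i → f i ≡ a

  image? : ∀ a → Dec (Image a)
  image? a = any? (λ i → f i ≟ a)

  ∑-reindex : (F : Fin n → ℕ) → (∀ a → ¬ Image a → F a ≡ 0) → sum F ≡ sum (F ∘ f)
  ∑-reindex F F-outside = begin
    sum F                                     ≡⟨ sum-cong-≗ spread ⟩
    ∑[ a < n ] ∑[ i < m ] (δ a (f i) * F a)   ≡⟨ ∑-comm (λ a i → δ a (f i) * F a) ⟩
    ∑[ i < m ] ∑[ a < n ] (δ a (f i) * F a)   ≡⟨ sum-cong-≗ (λ i → ∑-δ (f i) F) ⟩
    sum (F ∘ f)                               ∎
    where
    open ≡-Reasoning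
    spread : ∀ a → F a ≡ ∑[ i < m ] (δ a (f i) * F a)
    spread a with image? a
    ... | no a∉ = trans (F-outside a a∉) (sym (∑-zero (λ i → cong (_* F a) (δ-≢ (a∉ ∘ (i ,_) ∘ sym)))))
    ... | yes (i₀ , refl) = sym (begin
      ∑[ i < m ] (δ (f i₀) (f i) * F (f i₀))  ≡⟨ sum-cong-≗ (λ i → cong (_* F (f i₀)) (δ-injective-sym i)) ⟩
      ∑[ i < m ] (δ i i₀ * F (f i₀))          ≡⟨ ∑-δ i₀ (λ _ → F (f i₀)) ⟩
      F (f i₀)                                ∎)
      where
      δ-injective-sym : ∀ i → δ (f i₀) (f i) ≡ δ i i₀
      δ-injective-sym i = trans (δ-injective f f-injective i₀ i) (δ-sym i₀ i)

  letters-in-image : ∀ w → (∀ a → ¬ Image a → occ a w ≡ 0) → All Image w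
  letters-in-image []      _        = []
  letters-in-image (b ∷ w) occ-zero = head ∷ letters-in-image w (λ a a∉ → m+n≡0⇒n≡0 (δ a b) (occ-zero a a∉))
    where
    head : Image b
    head with image? b
    ... | yes b∈ = b∈
    ... | no b∉  = ⊥-elim (1+n≢0 (trans (cong (_+ occ b w) (sym (δ-refl b))) (occ-zero b b∉)))

  count-words-restrict : ∀ len (P : Word n → Bool) → (∀ w → T (P w) → All Image w) →
    count P (wordsOfLength n len) ≡ count (P ∘ map f) (wordsOfLength m len)
  count-words-restrict zero      P P⇒image with P []
  ... | true  = refl
  ... | false = refl
  count-words-restrict (suc len) P P⇒image = begin
    count P (wordsOfLength n (suc len))                       ≡⟨ count-words-suc P len ⟩
    ∑[ a < n ] count (P ∘ (a ∷_)) (wordsOfLength n len)       ≡⟨ ∑-reindex _ outside ⟩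
    ∑[ i < m ] count (P ∘ (f i ∷_)) (wordsOfLength n len)     ≡⟨ sum-cong-≗ restrict-tail ⟩
    ∑[ i < m ] count (P ∘ map f ∘ (i ∷_)) (wordsOfLength m len) ≡⟨ count-words-suc (P ∘ map f) len ⟨
    count (P ∘ map f) (wordsOfLength m (suc len))             ∎
    where
    open ≡-Reasoning
    outside : ∀ a → ¬ Image a → count (P ∘ (a ∷_)) (wordsOfLength n len) ≡ 0
    outside a a∉ = count-none (λ w P[a∷w] → a∉ (All.head (P⇒image (a ∷ w) P[a∷w]))) (wordsOfLength n len)
    restrict-tail : ∀ i → count (P ∘ (f i ∷_)) (wordsOfLength n len) ≡ count (P ∘ map f ∘ (i ∷_)) (wordsOfLength m len)
    restrict-tail i = count-words-restrict len (P ∘ (f i ∷_)) (λ w → All.tail ∘ P⇒image (f i ∷ w))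

  extend : (Fin m → ℕ) → Fin n → ℕ
  extend c a with image? a
  ... | yes (i , _) = c i
  ... | no _        = 0

  extend-image : ∀ c i → extend c (f i) ≡ c i
  extend-image c i with image? (f i)
  ... | yes (j , fj≡fi) = cong c (f-injective fj≡fi)
  ... | no fi∉          = ⊥-elim (fi∉ (i , refl))

  extend-outside : ∀ c {a} → ¬ Image a → extend c a ≡ 0
  extend-outside c {a} a∉ with image? a
  ... | yes a∈ = ⊥-elim (a∉ a∈)
  ... | no _   = refl

  total-extend : ∀ c → total (extend c) ≡ total c
  total-extend c = trans (∑-reindex (extend c) (λ _ → extend-outside c)) (sum-cong-≗ (extend-image c))

  occ-map : ∀ i w → occ (f i) (map f w) ≡ occ i w
  occ-map i []      = refl
  occ-map i (j ∷ w) = cong₂ _+_ (δ-injective f f-injective i j) (occ-map i w)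

  occ-map-outside : ∀ {a} → ¬ Image a → ∀ w → occ a (map f w) ≡ 0
  occ-map-outside a∉ []      = refl
  occ-map-outside a∉ (j ∷ w) = cong₂ _+_ (δ-≢ (a∉ ∘ (j ,_) ∘ sym)) (occ-map-outside a∉ w)

  inClass-map : ∀ c w → InClass (extend c) (map f w) ⇔ InClass c w
  inClass-map c w = mk⇔
    (λ h i → trans (sym (occ-map i w)) (trans (h (f i)) (extend-image c i)))
    occ-map-extend
    where
    occ-map-extend : InClass c w → ∀ a → occ a (map f w) ≡ extend c a
    occ-map-extend h a with image? a
    ... | yes (i , refl) = trans (occ-map i w) (h i)
    ... | no a∉          = occ-map-outside a∉ w

  inClassᵇ-map : ∀ c w → T (inClassᵇ (extend c) (map f w)) ⇔ T (inClassᵇ c w)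
  inClassᵇ-map c w = ⇔-trans (inClassᵇ⇔ (extend c) (map f w)) (⇔-trans (inClass-map c w) (⇔-sym (inClassᵇ⇔ c w)))

  countStat-restrict : (stat : Word n → ℕ) (stat′ : Word m → ℕ) → (∀ w → stat (map f w) ≡ stat′ w) →
    ∀ c k → countStat stat (extend c) k ≡ countStat stat′ c k
  countStat-restrict stat stat′ stat∘map c k = begin
    count P (wordsOfLength n (total (extend c)))          ≡⟨ count-words-restrict (total (extend c)) P P⇒image ⟩
    count (P ∘ map f) (wordsOfLength m (total (extend c))) ≡⟨ cong (count (P ∘ map f) ∘ wordsOfLength m) (total-extend c) ⟩
    count (P ∘ map f) (wordsOfLength m (total c))          ≡⟨ count-cong P∘map⇔P′ (wordsOfLength m (total c)) ⟩
    count P′ (wordsOfLength m (total c))                   ∎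
    where
    open ≡-Reasoning
    P : Word n → Bool
    P w = inClassᵇ (extend c) w ∧ (stat w ≡ᵇ k)
    P′ : Word m → Bool
    P′ w = inClassᵇ c w ∧ (stat′ w ≡ᵇ k)
    P⇒image : ∀ w → T (P w) → All Image w
    P⇒image w Pw = letters-in-image w (λ a a∉ →
      trans (Equivalence.to (inClassᵇ⇔ (extend c) w) (proj₁ (Equivalence.to T-∧ Pw)) a) (extend-outside c a∉))
    P∘map⇔P′ : ∀ w → T (P (map f w)) ⇔ T (P′ w)
    P∘map⇔P′ w rewrite stat∘map w =
      ⇔-trans T-∧ (⇔-trans (inClassᵇ-map c w ×-⇔ ⇔-refl) (⇔-sym T-∧))

  equidistributed-restrict : ∀ {U : Rel n} {V : Rel m} → (∀ i j → V i j ≡ U (f i) (f j)) →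
    EquidistributedOnAllClasses U → EquidistributedOnAllClasses V
  equidistributed-restrict {U} {V} V-restricts equi c k = begin
    countStat (inv′ V) c k           ≡⟨ countStat-restrict (inv′ U) (inv′ V) (inv′-map V-restricts) c k ⟨
    countStat (inv′ U) (extend c) k  ≡⟨ equi (extend c) k ⟩
    countStat (maj′ U) (extend c) k  ≡⟨ countStat-restrict (maj′ U) (maj′ V) (majFrom-map V-restricts 1) c k ⟩
    countStat (maj′ V) c k           ∎
    where open ≡-Reasoning

-- Relations on the small alphabets reach the finite checks as explicit tables, so that their
-- entries can be case-split and the counts then evaluated by normalisation.
fromTable : ∀ {m} → Vec (Vec Bool m) m → Rel m
fromTable t i j = lookup (lookup t i) j

toTable : ∀ {m} → Rel m → Vec (Vec Bool m) m
toTable V = Vec.tabulate (λ i → Vec.tabulate (V i))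

fromTable-toTable : ∀ {m} (V : Rel m) i j → fromTable (toTable V) i j ≡ V i j
fromTable-toTable V i j rewrite lookup∘tabulate (λ i → Vec.tabulate (V i)) i = lookup∘tabulate (V i) j

_restrictedTo_ : ∀ {m n} → Rel n → Vec (Fin n) m → Rel m
(U restrictedTo letters) i j = U (lookup letters i) (lookup letters j)

equidistributed-restrictedTo : ∀ {m n} {U : Rel n} (letters : Vec (Fin n) m) → Unique letters →
  EquidistributedOnAllClasses U → EquidistributedOnAllClasses (fromTable (toTable (U restrictedTo letters)))
equidistributed-restrictedTo {U = U} letters unique =
  SubAlphabet.equidistributed-restrict (lookup letters) (lookup-injective unique _ _)
    (fromTable-toTable (U restrictedTo letters))

two-letter-loop : (t : Vec (Vec Bool 2) 2) → fromTable t 0F 1F ≡ true → fromTable t 1F 0F ≡ true →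
  countStat (inv′ (fromTable t)) (lookup (2 ∷ 1 ∷ [])) 2 ≡ countStat (maj′ (fromTable t)) (lookup (2 ∷ 1 ∷ [])) 2 →
  fromTable t 0F 0F ≡ true
two-letter-loop ((true  ∷ _ ∷ []) ∷ _) _ _ _ = refl
two-letter-loop ((false ∷ _ ∷ []) ∷ (_ ∷ _ ∷ []) ∷ []) refl refl ()

three-letter-row-column : (t : Vec (Vec Bool 3) 3) → fromTable t 0F 1F ≡ true → fromTable t 1F 0F ≡ true →
  countStat (inv′ (fromTable t)) (λ _ → 1) 2 ≡ countStat (maj′ (fromTable t)) (λ _ → 1) 2 →
  fromTable t 2F 0F ≡ fromTable t 2F 1F × fromTable t 0F 2F ≡ fromTable t 1F 2F
three-letter-row-column ((_ ∷ _ ∷ xz ∷ []) ∷ (_ ∷ _ ∷ yz ∷ []) ∷ (zx ∷ zy ∷ _ ∷ []) ∷ []) refl refl agree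
  with xz | yz | zx | zy | agree
... | false | false | false | false | _  = refl , refl
... | false | false | false | true  | ()
... | false | false | true  | false | ()
... | false | false | true  | true  | _  = refl , refl
... | false | true  | false | false | ()
... | false | true  | false | true  | ()
... | false | true  | true  | false | ()
... | false | true  | true  | true  | ()
... | true  | false | false | false | ()
... | true  | false | false | true  | ()
... | true  | false | true  | false | ()
... | true  | false | true  | true  | ()
... | true  | true  | false | false | _  = refl , refl
... | true  | true  | false | true  | ()
... | true  | true  | true  | false | ()
... | true  | true  | true  | true  | _  = refl , refl

module _ {n} {U : Rel n} (equi : EquidistributedOnAllClasses U) where

  S⇒loop : ∀ {x y} → x ≢ y → S U x y → U x x ≡ true
  S⇒loop {x} {y} x≢y (Uxy , Uyx) =
    two-letter-loop (toTable (U restrictedTo (x ∷ y ∷ []))) Uxy Uyx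
      (equidistributed-restrictedTo (x ∷ y ∷ []) ((x≢y ∷ []) ∷ [] ∷ []) equi (lookup (2 ∷ 1 ∷ [])) 2)

  S⇒row-column-agree : ∀ {x y z} → x ≢ y → z ≢ x → z ≢ y → S U x y → U z x ≡ U z y × U x z ≡ U y z
  S⇒row-column-agree {x} {y} {z} x≢y z≢x z≢y (Uxy , Uyx) =
    three-letter-row-column (toTable (U restrictedTo (x ∷ y ∷ z ∷ []))) Uxy Uyx
      (equidistributed-restrictedTo (x ∷ y ∷ z ∷ [])
        ((x≢y ∷ (z≢x ∘ sym) ∷ []) ∷ ((z≢y ∘ sym) ∷ []) ∷ [] ∷ []) equi (λ _ → 1) 2)

  sameBlock⇒row-column-agree : ∀ {x y} → DistinctSameBlock U x y → ∀ z → U z x ≡ U z y × U x z ≡ U y z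
  sameBlock⇒row-column-agree {x} {y} (x≢y , Sxy@(Uxy , Uyx)) z with z ≟ x | z ≟ y
  ... | yes refl | _        = trans Uxx (sym Uxy) , trans Uxx (sym Uyx)
    where
    Uxx : U x x ≡ true
    Uxx = S⇒loop x≢y Sxy
  ... | no _     | yes refl = trans Uyx (sym Uyy) , trans Uxy (sym Uyy)
    where
    Uyy : U y y ≡ true
    Uyy = S⇒loop (x≢y ∘ sym) (swap Sxy)
  ... | no z≢x   | no z≢y   = S⇒row-column-agree x≢y z≢x z≢y Sxy

lemma6p5 : (n : ℕ) (U : Rel n) → EquidistributedOnAllClasses U →
    (x y : Fin n) → DistinctSameBlock U x y → (z : Fin n) →
    ((U z x ≡ true) ⇔ (U z y ≡ true)) × ((U x z ≡ true) ⇔ (U y z ≡ true))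
lemma6p5 n U equi x y block z = Product.map ≡⇒⇔ ≡⇒⇔ (sameBlock⇒row-column-agree equi block z)
  where
  ≡⇒⇔ : ∀ {a b : Bool} → a ≡ b → (a ≡ true) ⇔ (b ≡ true)
  ≡⇒⇔ a≡b = mk⇔ (trans (sym a≡b)) (trans a≡b)
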